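{- Let $G=(V,E)$ be a graph, $L$ an ordered list of pairs of vertices, and $u,v\in V$. Suppose $u$ is matched in $\textsc{R}(L_{ -v})$ but unmatched in $\textsc{R}(L)$. Let $u_0,\ldots,u_k$ be the alternating path $\textsc{R}(L)\oplus\textsc{R}(L_{ -v})$, where $u_0=v$ and $u_k=u$. Then for every even $i<k$, $u$ is the victim of $u_i$ with respect to $L$.
   Context: Greedy (query-commit) matching with list $L$: go through the pairs $(a,b)\in L$ in order; if $\{a,b\}\in E$ and both $a,b$ are available, match them and mark both unavailable; $\textsc{R}(L)$ is the resulting matching. For a vertex $w$, $L_{ -w}$ denotes $L$ run with $w$ marked unavailable from the start. The symmetric difference $\textsc{R}(L)\oplus\textsc{R}(L_{ -v})$ is a path starting at $v$ alternating between edges of $\textsc{R}(L)$ (from even-indexed vertices) and of $\textsc{R}(L_{ -v})$. Victim/blocker: $u$ is the victim of $w$ (and $w$ a blocker of $u$) with respect to $L$ if $u$ is unmatched in $\textsc{R}(L)$ and $u$ is matched in $\textsc{R}(L_{ -w})$. -}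

module Defs where

open import Data.Nat using (ℕ; zero; suc; _≤_; _<_)
open import Data.Fin using (Fin; _≟_)
open import Data.Bool using (Bool; true; false; _∧_; not; if_then_else_)
open import Data.Product using (_×_; _,_; ∃)
open import Data.Sum using (_⊎_)
open import Data.List using (List; []; _∷_)
open import Data.List.Membership.Propositional using (_∈_)
open import Relation.Nullary using (¬_; does)
open import Relation.Binary.PropositionalEquality using (_≡_)

record Graph (n : ℕ) : Set where
  field
    adj     : Fin n → Fin n → Bool
    adj-sym : ∀ a b → adj a b ≡ adj b a
    irrefl  : ∀ a → adj a a ≡ false
open Graph public

Pair : ℕ → Set
Pair n = Fin n × Fin n

markUsed : ∀ {n} → Fin n → Fin n → (Fin n → Bool) → (Fin n → Bool)
markUsed a b av x = if does (x ≟ a) then false else (if does (x ≟ b) then false else av x)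

greedy : ∀ {n} → Graph n → (Fin n → Bool) → List (Pair n) → List (Pair n)
greedy G av [] = []
greedy G av ((a , b) ∷ L) =
  if adj G a b ∧ av a ∧ av b
  then (a , b) ∷ greedy G (markUsed a b av) L
  else greedy G av L

R : ∀ {n} → Graph n → List (Pair n) → List (Pair n)
R G L = greedy G (λ _ → true) L

-- R(L_{-w}): w marked unavailable from the start
R₋ : ∀ {n} → Graph n → Fin n → List (Pair n) → List (Pair n)
R₋ G w L = greedy G (λ x → not (does (x ≟ w))) L

InM : ∀ {n} → List (Pair n) → Fin n → Fin n → Set
InM M a b = ((a , b) ∈ M) ⊎ ((b , a) ∈ M)

Matched : ∀ {n} → Fin n → List (Pair n) → Set
Matched u M = ∃ λ x → InM M u x

InSymDiff : ∀ {n} → List (Pair n) → List (Pair n) → Fin n → Fin n → Set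
InSymDiff M₁ M₂ a b = (InM M₁ a b × ¬ InM M₂ a b) ⊎ (InM M₂ a b × ¬ InM M₁ a b)

Victim : ∀ {n} → Graph n → List (Pair n) → (u w : Fin n) → Set
Victim G L u w = ¬ Matched u (R G L) × Matched u (R₋ G w L)

Even : ℕ → Set
Even i = ∃ λ j → i ≡ j Data.Nat.+ j
  where import Data.Nat

IsAltPath : ∀ {n} → List (Pair n) → List (Pair n) → (k : ℕ) → (ℕ → Fin n) → Set
IsAltPath M₁ M₂ k p =
  (∀ i j → i ≤ k → j ≤ k → p i ≡ p j → i ≡ j)
  × (∀ a b → InSymDiff M₁ M₂ a b →
       ∃ λ i → i < k × (((a ≡ p i) × (b ≡ p (suc i))) ⊎ ((b ≡ p i) × (a ≡ p (suc i)))))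
  × (∀ i → i < k → InSymDiff M₁ M₂ (p i) (p (suc i)))
  × (∀ i → i < k → Even i → InM M₁ (p i) (p (suc i)))
  × (∀ i → i < k → ¬ Even i → InM M₂ (p i) (p (suc i)))

{-# OPTIONS --safe #-}
-- Run the greedy algorithm simultaneously from three availability vectors B, S and C.  Invariant:
-- the runs from B and from S = B ∖ q 0 on the rest of the list differ exactly along an
-- alternating path q 0 … q k, and C is B or S, according to the parity of j, minus q j, where
-- j ≡ k (mod 2).  A pair rejected by B is rejected by all three runs, and a pair accepted by both
-- B and S avoids the path, so C accepts it as well.  Otherwise B takes the first path edge q 0 q 1
-- and S cannot; then S and B ∖ q 0 ∖ q 1 play the roles of B and S for the path q 1 … q k, and
-- the invariant holds again with j and k decreased by one.  Once j = 0, C coincides with S, whose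
-- run matches the endpoint q k.  Initially B admits every vertex, S removes v = p 0 and C removes
-- w = p i.
module Submission where

open import Defs
open import Level using (Level)
open import Data.Nat using (ℕ; zero; suc; _<_; _≤_; z≤n; s≤s)
open import Data.Nat.Properties using (+-suc; suc-injective; <⇒≤; m<n⇒m<1+n; ≤-refl; ≤-trans)
open import Data.Fin using (Fin; _≟_)
open import Data.Bool using (Bool; true; false; T; T?; _∧_; not; if_then_else_)
open import Data.Bool.Properties using (T-∧; ∧-assoc; ∧-comm; ∧-zeroʳ; ∧-identityʳ)
open import Data.Product using (_×_; _,_; proj₁; proj₂; map₂)
open import Data.Sum using (_⊎_; inj₁; inj₂; [_,_]; swap)
import Data.Sum as Sum
open import Data.List using (List; []; _∷_)
open import Data.List.Relation.Unary.Any using (here; there)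
open import Data.Empty using (⊥-elim)
open import Function using (_∘_; id)
open import Function.Bundles using (Equivalence)
open import Relation.Nullary using (¬_; Dec; yes; no; does)
open import Relation.Nullary.Decidable using (_×-dec_)
open import Relation.Binary.PropositionalEquality
  using (_≡_; _≢_; _≗_; refl; sym; trans; cong; cong₂; subst; subst₂; module ≡-Reasoning)

private variable
  ℓ ℓ′ : Level
  A A′ : Set ℓ′

alternate : ℕ → A → A → A
alternate zero    x y = x
alternate (suc i) x y = alternate i y x

alternate-elim : (P : A → Set ℓ) → ∀ i {x y} → P x → P y → P (alternate i x y)
alternate-elim P zero    px py = px
alternate-elim P (suc i) px py = alternate-elim P i py px

alternate-rel : (R : A → A′ → Set ℓ) → ∀ i {x y x′ y′} →
  R x x′ → R y y′ → R (alternate i x y) (alternate i x′ y′)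
alternate-rel R zero    rx ry = rx
alternate-rel R (suc i) rx ry = alternate-rel R i ry rx

alternate-map : (f : A → A′) → ∀ i {x y} → alternate i (f x) (f y) ≡ f (alternate i x y)
alternate-map f zero    = refl
alternate-map f (suc i) = alternate-map f i

-- Stated through alternate so that SameParity (suc i) (suc j) is SameParity i j with x, y swapped.
SameParity : ℕ → ℕ → Set₁
SameParity i j = ∀ {A : Set} (x y : A) → alternate i x y ≡ alternate j x y

parity : ∀ i → SameParity i 0 ⊎ SameParity i 1
parity zero = inj₁ λ _ _ → refl
parity (suc i) with parity i
... | inj₁ even = inj₂ λ x y → even y x
... | inj₂ odd  = inj₁ λ x y → odd y x

odd-positive : ∀ {i} → SameParity i 1 → 1 ≤ i
odd-positive {zero} odd with odd true false
... | ()
odd-positive {suc i} _ = s≤s z≤n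

even-parity : ∀ {i} → Even i → SameParity i 0
even-parity (zero , refl) x y = refl
even-parity (suc m , refl) x y rewrite +-suc m m = even-parity (m , refl) x y

odd-parity : ∀ {i} → Even (suc i) → SameParity i 1
odd-parity even x y = even-parity even y x

even-or-odd : ∀ i → Even i ⊎ Even (suc i)
even-or-odd zero = inj₁ (0 , refl)
even-or-odd (suc i) with even-or-odd i
... | inj₁ (m , refl) = inj₂ (suc m , cong suc (sym (+-suc m m)))
... | inj₂ even       = inj₁ even

even⇒¬odd : ∀ {i} → Even i → ¬ Even (suc i)
even⇒¬odd even odd with trans (sym (even-parity even true false)) (odd-parity odd true false)
... | ()

module _ {n : ℕ} where

  private variable
    M N : List (Pair n)
    e : Pair n
    v w x : Fin n

  Touches : Pair n → Fin n → Set
  Touches (a , b) v = v ≡ a ⊎ v ≡ b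

  Ends : Pair n → Fin n → Fin n → Set
  Ends e v w = e ≡ (v , w) ⊎ e ≡ (w , v)

  ends⇒touches : Ends e v w → Touches e v
  ends⇒touches (inj₁ refl) = inj₁ refl
  ends⇒touches (inj₂ refl) = inj₂ refl

  touches-ends : Ends e v w → Touches e x → x ≡ v ⊎ x ≡ w
  touches-ends (inj₁ refl) t = t
  touches-ends (inj₂ refl) t = swap t

  InM-sym : InM M v w → InM M w v
  InM-sym = swap

  InM-∷⁺ : InM M v w → InM (e ∷ M) v w
  InM-∷⁺ (inj₁ h) = inj₁ (there h)
  InM-∷⁺ (inj₂ h) = inj₂ (there h)

  InM-∷⁻ : InM (e ∷ M) v w → Ends e v w ⊎ InM M v w
  InM-∷⁻ (inj₁ (here eq)) = inj₁ (inj₁ (sym eq))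
  InM-∷⁻ (inj₂ (here eq)) = inj₁ (inj₂ (sym eq))
  InM-∷⁻ (inj₁ (there h)) = inj₂ (inj₁ h)
  InM-∷⁻ (inj₂ (there h)) = inj₂ (inj₂ h)

  ends⇒InM : Ends e v w → InM (e ∷ M) v w
  ends⇒InM (inj₁ refl) = inj₁ (here refl)
  ends⇒InM (inj₂ refl) = inj₂ (here refl)

  InM-∷-cancel : InM (e ∷ M) v w → ¬ InM (e ∷ N) v w → InM M v w
  InM-∷-cancel h ¬h = [ ⊥-elim ∘ ¬h ∘ ends⇒InM , id ] (InM-∷⁻ h)

  InM-∷-untouched : ¬ Touches e v → InM (e ∷ M) v w → InM M v w
  InM-∷-untouched ¬t h = [ ⊥-elim ∘ ¬t ∘ ends⇒touches , id ] (InM-∷⁻ h)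

  Matched-∷⁺ : Matched v M → Matched v (e ∷ M)
  Matched-∷⁺ (w , h) = w , InM-∷⁺ h

  Matched-∷⁻ : Matched v (e ∷ M) → Touches e v ⊎ Matched v M
  Matched-∷⁻ (w , h) = Sum.map ends⇒touches (w ,_) (InM-∷⁻ h)

  Matched-∷-cancel : Matched v (e ∷ M) → ¬ Matched v (e ∷ N) → Matched v M
  Matched-∷-cancel (w , h) ¬m = w , InM-∷-cancel h (¬m ∘ (w ,_))

  Matched-∷-untouched : ¬ Touches e v → Matched v (e ∷ M) → Matched v M
  Matched-∷-untouched ¬t (w , h) = w , InM-∷-untouched ¬t h

  ¬Matched-[] : ¬ Matched v []
  ¬Matched-[] (_ , inj₁ ())
  ¬Matched-[] (_ , inj₂ ())

  symDiff-exclusive : InSymDiff M N v w → InM M v w → ¬ InM N v w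
  symDiff-exclusive (inj₁ (_ , ¬n)) _ = ¬n
  symDiff-exclusive (inj₂ (_ , ¬m)) m = ⊥-elim (¬m m)

record Alternating {n} (M N : List (Pair n)) (q : ℕ → Fin n) (k : ℕ) : Set where
  field
    simple   : ∀ i j → i ≤ k → j ≤ k → q i ≡ q j → i ≡ j
    edge-in  : ∀ i → i < k → InM (alternate i M N) (q i) (q (suc i))
    edge-out : ∀ i → i < k → ¬ InM (alternate i N M) (q i) (q (suc i))
    end-in   : Matched (q k) (alternate k N M)
    end-out  : ¬ Matched (q k) (alternate k M N)

  beyond-first-edge : ∀ {e m} → Ends e (q 0) (q 1) → 2 ≤ m → m ≤ k → ¬ Touches e (q m)
  beyond-first-edge ends (s≤s (s≤s _)) m≤k t with touches-ends ends t
  ... | inj₁ eq with simple _ 0 m≤k z≤n eq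
  ...   | ()
  beyond-first-edge ends (s≤s (s≤s _)) m≤k t | inj₂ eq
    with simple _ 1 m≤k (≤-trans (s≤s z≤n) m≤k) eq
  ...   | ()

module _ {n : ℕ} {M N : List (Pair n)} {e : Pair n} {q : ℕ → Fin n} where

  alternating-tail : ∀ {k} → Alternating (e ∷ M) (e ∷ N) q k → Alternating M N q k
  alternating-tail {k} alt = record
    { simple   = simple
    ; edge-in  = λ i i<k →
        InM-∷-cancel (subst (λ X → InM X _ _) (cons i) (edge-in i i<k))
                     (subst (λ X → ¬ InM X _ _) (cons i) (edge-out i i<k))
    ; edge-out = λ i i<k → edge-out i i<k ∘ subst (λ X → InM X _ _) (sym (cons i)) ∘ InM-∷⁺
    ; end-in   = Matched-∷-cancel (subst (Matched _) (cons k) end-in)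
                                  (subst (λ X → ¬ Matched _ X) (cons k) end-out)
    ; end-out  = end-out ∘ subst (Matched _) (sym (cons k)) ∘ Matched-∷⁺
    }
    where
      open Alternating alt
      cons : ∀ i {X Y} → alternate i (e ∷ X) (e ∷ Y) ≡ e ∷ alternate i X Y
      cons = alternate-map (e ∷_)

  alternating-shift : ∀ {k} → Ends e (q 0) (q 1) → 0 < k →
    Alternating (e ∷ M) N q (suc k) → Alternating N M (q ∘ suc) k
  alternating-shift {k} ends 0<k alt = record
    { simple   = λ i j i≤k j≤k eq →
        suc-injective (simple (suc i) (suc j) (s≤s i≤k) (s≤s j≤k) eq)
    ; edge-in  = λ i i<k → alternate-rel (λ X Y → InM X _ _ → InM Y _ _) i id
        (InM-sym ∘ InM-∷-untouched (beyond (s≤s z≤n) i<k) ∘ InM-sym)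
        (edge-in (suc i) (s≤s i<k))
    ; edge-out = λ i i<k → alternate-rel (λ X Y → ¬ InM X _ _ → ¬ InM Y _ _) i
        (_∘ InM-∷⁺) id (edge-out (suc i) (s≤s i<k))
    ; end-in   = alternate-rel (λ X Y → Matched _ X → Matched _ Y) k
        (Matched-∷-untouched (beyond 0<k ≤-refl)) id end-in
    ; end-out  = alternate-rel (λ X Y → ¬ Matched _ X → ¬ Matched _ Y) k
        id (_∘ Matched-∷⁺) end-out
    }
    where
      open Alternating alt
      beyond : ∀ {m} → 1 ≤ m → m ≤ k → ¬ Touches e (q (suc m))
      beyond 1≤m m≤k = beyond-first-edge ends (s≤s 1≤m) (s≤s m≤k)

Avail : ℕ → Set
Avail n = Fin n → Bool

module _ {n : ℕ} where

  private variable
    av av′ av″ : Avail n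
    v w x : Fin n

  infixl 6 _∖_
  infix 4 _⊑_

  _∖_ : Avail n → Fin n → Avail n
  (av ∖ w) x = av x ∧ not (does (x ≟ w))

  _⊑_ : Avail n → Avail n → Set
  av ⊑ av′ = ∀ x → T (av x) → T (av′ x)

  ⊑-refl : av ⊑ av
  ⊑-refl _ = id

  ⊑-trans : av ⊑ av′ → av′ ⊑ av″ → av ⊑ av″
  ⊑-trans p q x = q x ∘ p x

  ≗⇒⊑ : av ≗ av′ → av ⊑ av′
  ≗⇒⊑ eq x = subst T (eq x)

  ∖-intro : T (av x) → x ≢ w → T ((av ∖ w) x)
  ∖-intro {x = x} {w} t x≢w with x ≟ w
  ... | yes x≡w = ⊥-elim (x≢w x≡w)
  ... | no _    = Equivalence.from T-∧ (t , _)

  ∖-elim : T ((av ∖ w) x) → T (av x) × x ≢ w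
  ∖-elim {av = av} {w = w} {x = x} t with Equivalence.to (T-∧ {av x}) t
  ... | t′ , kept with x ≟ w
  ...   | yes _   = ⊥-elim kept
  ...   | no x≢w  = t′ , x≢w

  ∖-⊑ : av ∖ w ⊑ av
  ∖-⊑ {av} _ = proj₁ ∘ ∖-elim {av}

  ∖-cong : av ≗ av′ → av ∖ w ≗ av′ ∖ w
  ∖-cong eq x = cong (_∧ _) (eq x)

  ∖-comm : (av ∖ v) ∖ w ≗ (av ∖ w) ∖ v
  ∖-comm {av} {v} {w} x =
    trans (∧-assoc (av x) _ _)
          (trans (cong (av x ∧_) (∧-comm (not (does (x ≟ v))) _)) (sym (∧-assoc (av x) _ _)))

  markUsed-cong : ∀ {a b} → av ≗ av′ → markUsed a b av ≗ markUsed a b av′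
  markUsed-cong {a = a} {b} eq x =
    cong (λ y → if does (x ≟ a) then false else (if does (x ≟ b) then false else y)) (eq x)

  markUsed-≗ : ∀ {a b} → markUsed a b av ≗ (av ∖ a) ∖ b
  markUsed-≗ {av} {a} {b} x with does (x ≟ a) | does (x ≟ b)
  ... | true  | r     = sym (cong (_∧ not r) (∧-zeroʳ (av x)))
  ... | false | true  = sym (∧-zeroʳ _)
  ... | false | false = sym (trans (∧-identityʳ _) (∧-identityʳ _))

  markUsed-∖ : ∀ {a b} → markUsed a b (av ∖ w) ≗ markUsed a b av ∖ w
  markUsed-∖ {a = a} {b} x with does (x ≟ a) | does (x ≟ b)
  ... | true  | _     = refl
  ... | false | true  = refl
  ... | false | false = refl

  markUsed-ends : ∀ {a b} → Ends (a , b) v w → markUsed a b av ≗ (av ∖ v) ∖ w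
  markUsed-ends {av = av} (inj₁ refl) = markUsed-≗ {av}
  markUsed-ends {av = av} (inj₂ refl) x = trans (markUsed-≗ {av} x) (∖-comm {av} x)

  markUsed-available : ∀ {a b} → T (markUsed a b av x) → ¬ Touches (a , b) x × T (av x)
  markUsed-available {x = x} {a = a} {b = b} t with x ≟ a | x ≟ b
  markUsed-available () | yes _ | _
  markUsed-available () | no _  | yes _
  markUsed-available t  | no x≢a | no x≢b = [ x≢a , x≢b ] , t

module _ {n : ℕ} (G : Graph n) where

  private variable
    L : List (Pair n)
    av av′ B S C : Avail n
    a b v w : Fin n

  Accepts : Avail n → Fin n → Fin n → Set
  Accepts av a b = T (adj G a b) × T (av a) × T (av b)

  accepts? : ∀ av a b → Dec (Accepts av a b)
  accepts? av a b = T? (adj G a b) ×-dec T? (av a) ×-dec T? (av b)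

  accepts-mono : av ⊑ av′ → Accepts av a b → Accepts av′ a b
  accepts-mono sub (ab , a✓ , b✓) = ab , sub _ a✓ , sub _ b✓

  accepts-∖ : Accepts av a b → ¬ Touches (a , b) w → Accepts (av ∖ w) a b
  accepts-∖ {av} (ab , a✓ , b✓) ¬t =
    ab , ∖-intro {av = av} a✓ (¬t ∘ inj₁ ∘ sym) , ∖-intro {av = av} b✓ (¬t ∘ inj₂ ∘ sym)

  rejected-after-removal : Accepts av a b → ¬ Accepts (av ∖ w) a b → Touches (a , b) w
  rejected-after-removal {a = a} {b} {w} acc rej with w ≟ a | w ≟ b
  ... | yes w≡a | _       = inj₁ w≡a
  ... | no _    | yes w≡b = inj₂ w≡b
  ... | no w≢a  | no w≢b  = ⊥-elim (rej (accepts-∖ acc [ w≢a , w≢b ]))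

  accepts⇒T : Accepts av a b → T (adj G a b ∧ av a ∧ av b)
  accepts⇒T {av} {a} (ab , a✓ , b✓) =
    Equivalence.from T-∧ (ab , Equivalence.from (T-∧ {av a}) (a✓ , b✓))

  T⇒accepts : T (adj G a b ∧ av a ∧ av b) → Accepts av a b
  T⇒accepts {a = a} {av = av} t = map₂ (Equivalence.to (T-∧ {av a})) (Equivalence.to T-∧ t)

  greedy-accept : Accepts av a b →
    greedy G av ((a , b) ∷ L) ≡ (a , b) ∷ greedy G (markUsed a b av) L
  greedy-accept {av} {a} {b} acc with adj G a b ∧ av a ∧ av b | accepts⇒T acc
  ... | true  | _  = refl
  ... | false | ()

  greedy-reject : ¬ Accepts av a b → greedy G av ((a , b) ∷ L) ≡ greedy G av L
  greedy-reject {av} {a} {b} rej with adj G a b ∧ av a ∧ av b in accepted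
  ... | false = refl
  ... | true  = ⊥-elim (rej (T⇒accepts (subst T (sym accepted) _)))

  next : Avail n → Pair n → Avail n
  next av (a , b) = if adj G a b ∧ av a ∧ av b then markUsed a b av else av

  next-accept : Accepts av a b → next av (a , b) ≡ markUsed a b av
  next-accept {av} {a} {b} acc with adj G a b ∧ av a ∧ av b | accepts⇒T acc
  ... | true  | _  = refl
  ... | false | ()

  next-reject : ¬ Accepts av a b → next av (a , b) ≡ av
  next-reject {av} {a} {b} rej with adj G a b ∧ av a ∧ av b in accepted
  ... | false = refl
  ... | true  = ⊥-elim (rej (T⇒accepts (subst T (sym accepted) _)))

  matched-next : ∀ {e} L → Matched v (greedy G (next av e) L) → Matched v (greedy G av (e ∷ L))
  matched-next {av = av} {e = a , b} L m with adj G a b ∧ av a ∧ av b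
  ... | true  = Matched-∷⁺ m
  ... | false = m

  greedy-cong : av ≗ av′ → ∀ L → greedy G av L ≡ greedy G av′ L
  greedy-cong eq [] = refl
  greedy-cong {av′ = av′} eq ((a , b) ∷ L) rewrite eq a | eq b =
    cong₂ (λ t f → if adj G a b ∧ av′ a ∧ av′ b then t else f)
          (cong ((a , b) ∷_) (greedy-cong (markUsed-cong eq) L)) (greedy-cong eq L)

  matched-available : ∀ L → Matched v (greedy G av L) → T (av v)
  matched-available [] m = ⊥-elim (¬Matched-[] m)
  matched-available {v = v} {av = av} ((a , b) ∷ L) m with accepts? av a b
  ... | no rej = matched-available L (subst (Matched v) (greedy-reject {L = L} rej) m)
  ... | yes acc@(_ , a✓ , b✓) =
    [ [ (λ { refl → a✓ }) , (λ { refl → b✓ }) ] , available-before ]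
      (Matched-∷⁻ (subst (Matched v) (greedy-accept {L = L} acc) m))
    where
      available-before : Matched v (greedy G (markUsed a b av) L) → T (av v)
      available-before = proj₂ ∘ markUsed-available {av = av} ∘ matched-available L

  matched-after-markUsed : ∀ L → Matched v (greedy G (markUsed a b av) L) → ¬ Touches (a , b) v
  matched-after-markUsed {av = av} L = proj₁ ∘ markUsed-available {av = av} ∘ matched-available L

  first-partner : ∀ L → Touches (a , b) v → InM ((a , b) ∷ greedy G (markUsed a b av) L) v w →
    Ends (a , b) v w
  first-partner L t h = [ id , (λ h′ → ⊥-elim (matched-after-markUsed L (_ , h′) t)) ] (InM-∷⁻ h)

  record Blocking (L : List (Pair n)) (B S C : Avail n) (q : ℕ → Fin n) (j k : ℕ) : Set₁ where
    field
      start-removed   : S ≗ B ∖ q 0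
      blocker-removed : C ≗ alternate j B S ∖ q j
      same-parity     : SameParity j k
      alternating     : Alternating (greedy G B L) (greedy G S L) q k

    S⊑B : S ⊑ B
    S⊑B = ⊑-trans (≗⇒⊑ start-removed) (∖-⊑ {av = B})

    C⊑B : C ⊑ B
    C⊑B = ⊑-trans (≗⇒⊑ blocker-removed)
            (⊑-trans (∖-⊑ {av = alternate j B S}) (alternate-elim (_⊑ B) j ⊑-refl S⊑B))

  private variable
    q : ℕ → Fin n
    j k : ℕ

  reject-step : ¬ Accepts B a b → Blocking ((a , b) ∷ L) B S C q j k →
    Blocking L B S (next C (a , b)) q j k
  reject-step {L = L} {q = q} {k = k} ¬B bl = record
    { start-removed   = start-removed
    ; blocker-removed = λ x →
        trans (cong (λ X → X x) (next-reject (¬B ∘ accepts-mono C⊑B))) (blocker-removed x)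
    ; same-parity     = same-parity
    ; alternating     = subst₂ (λ X Y → Alternating X Y q k)
        (greedy-reject {L = L} ¬B) (greedy-reject {L = L} (¬B ∘ accepts-mono S⊑B)) alternating
    }
    where open Blocking bl

  common-step : Accepts B a b → Accepts S a b → j < k →
    Blocking ((a , b) ∷ L) B S C q (suc j) k →
    Blocking L (markUsed a b B) (markUsed a b S) (next C (a , b)) q (suc j) k
  common-step {B} {a} {b} {S} {j} {k} {L} {C} {q} B✓ S✓ j<k bl = record
    { start-removed   = λ x → trans (markUsed-cong start-removed x) (markUsed-∖ {av = B} x)
    ; blocker-removed = λ x → begin
        next C (a , b) x
          ≡⟨ cong (λ X → X x) (next-accept C✓) ⟩
        markUsed a b C x
          ≡⟨ markUsed-cong blocker-removed x ⟩
        markUsed a b (alternate (suc j) B S ∖ q (suc j)) x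
          ≡⟨ markUsed-∖ {av = alternate (suc j) B S} x ⟩
        (markUsed a b (alternate (suc j) B S) ∖ q (suc j)) x
          ≡⟨ cong (λ X → (X ∖ q (suc j)) x) (sym (alternate-map (markUsed a b) (suc j))) ⟩
        (alternate (suc j) (markUsed a b B) (markUsed a b S) ∖ q (suc j)) x ∎
    ; same-parity     = same-parity
    ; alternating     = tail
    }
    where
      open Blocking bl
      open ≡-Reasoning
      tail : Alternating (greedy G (markUsed a b B) L) (greedy G (markUsed a b S) L) q k
      tail = alternating-tail (subst₂ (λ X Y → Alternating X Y q k)
               (greedy-accept {L = L} B✓) (greedy-accept {L = L} S✓) alternating)
      untouched : ¬ Touches (a , b) (q (suc j))
      untouched = alternate-elim (λ X → Matched (q (suc j)) X → ¬ Touches (a , b) (q (suc j))) j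
        (matched-after-markUsed L) (matched-after-markUsed L)
        (q j , InM-sym (Alternating.edge-in tail j j<k))
      C✓ : Accepts C a b
      C✓ = accepts-mono (≗⇒⊑ (sym ∘ blocker-removed))
             (accepts-∖ (alternate-elim (λ X → Accepts X a b) (suc j) B✓ S✓) untouched)

  shift-step : Accepts B a b → ¬ Accepts S a b → j < k →
    Blocking ((a , b) ∷ L) B S C q (suc j) (suc k) →
    Blocking L S (markUsed a b B) (next C (a , b)) (q ∘ suc) j k
  shift-step {B} {a} {b} {S} {j} {k} {L} {C} {q} B✓ ¬S j<k bl = record
    { start-removed   = λ x →
        trans (markUsed-ends {av = B} ends x) (∖-cong (sym ∘ start-removed) x)
    ; blocker-removed = blocker-removed′
    ; same-parity     = λ x y → same-parity y x
    ; alternating     = alternating-shift ends (≤-trans (s≤s z≤n) j<k) path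
    }
    where
      open Blocking bl
      path : Alternating ((a , b) ∷ greedy G (markUsed a b B) L) (greedy G S L) q (suc k)
      path = subst₂ (λ X Y → Alternating X Y q (suc k))
               (greedy-accept {L = L} B✓) (greedy-reject {L = L} ¬S) alternating
      ends : Ends (a , b) (q 0) (q 1)
      ends = first-partner L
        (rejected-after-removal B✓ (¬S ∘ accepts-mono (≗⇒⊑ (sym ∘ start-removed))))
        (Alternating.edge-in path 0 (s≤s z≤n))
      C≗ : ∀ {X} → alternate j S B ≡ X → C ≗ X ∖ q (suc j)
      C≗ eq x = trans (blocker-removed x) (cong (λ Y → (Y ∖ q (suc j)) x) eq)
      rejected-if-even : SameParity j 0 → ¬ Accepts C a b
      rejected-if-even even =
        ¬S ∘ accepts-mono (⊑-trans (≗⇒⊑ (C≗ (even S B))) (∖-⊑ {av = S}))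
      accepted-if-odd : SameParity j 1 → Accepts C a b
      accepted-if-odd odd = accepts-mono (≗⇒⊑ (sym ∘ C≗ (odd S B))) (accepts-∖ B✓
        (Alternating.beyond-first-edge path ends (s≤s (odd-positive odd)) (s≤s (<⇒≤ j<k))))
      blocker-removed′ : next C (a , b) ≗ alternate j S (markUsed a b B) ∖ q (suc j)
      blocker-removed′ with parity j
      ... | inj₁ even rewrite even S (markUsed a b B) | next-reject (rejected-if-even even) =
        C≗ (even S B)
      ... | inj₂ odd rewrite odd S (markUsed a b B) | next-accept (accepted-if-odd odd) =
        λ x → trans (markUsed-cong (C≗ (odd S B)) x) (markUsed-∖ {av = B} x)

  victim-matched : ∀ L {B S C : Avail n} {q : ℕ → Fin n} {j k} → j < k →
    Blocking L B S C q j k → Matched (q k) (greedy G C L)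
  victim-matched L {j = zero} _ bl =
    subst (Matched _) (greedy-cong (λ x → trans (start-removed x) (sym (blocker-removed x))) L)
      (subst (Matched _) (sym (same-parity _ _)) (Alternating.end-in alternating))
    where open Blocking bl
  victim-matched [] {j = suc j} {k} _ bl =
    ⊥-elim (¬Matched-[] (subst (Matched _) (alternate-elim (_≡ []) k refl refl)
                                           (Alternating.end-in alternating)))
    where open Blocking bl
  victim-matched ((a , b) ∷ L) {B} {S} {j = suc j} {suc k} (s≤s j<k) bl
    with accepts? B a b | accepts? S a b
  ... | no ¬B  | _      = matched-next L (victim-matched L (s≤s j<k) (reject-step ¬B bl))
  ... | yes B✓ | yes S✓ =
    matched-next L (victim-matched L (s≤s j<k) (common-step B✓ S✓ (m<n⇒m<1+n j<k) bl))
  ... | yes B✓ | no ¬S  = matched-next L (victim-matched L j<k (shift-step B✓ ¬S j<k bl))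

module _ {n : ℕ} {M N : List (Pair n)} {p : ℕ → Fin n} where

  even-length : ∀ k → IsAltPath M N k p → ¬ Matched (p k) M → Even k
  even-length zero    _                         _       = 0 , refl
  even-length (suc k) (_ , _ , _ , even-in , _) end-out with even-or-odd k
  ... | inj₁ even = ⊥-elim (end-out (_ , InM-sym (even-in k ≤-refl even)))
  ... | inj₂ odd  = odd

  isAltPath⇒alternating : ∀ {k} → IsAltPath M N k p → Even k →
    Matched (p k) N → ¬ Matched (p k) M → Alternating M N p k
  isAltPath⇒alternating {k} (simple , _ , symDiff , even-in , odd-in) even-k end-in end-out = record
    { simple   = simple
    ; edge-in  = λ i i<k → proj₁ (edge i i<k)
    ; edge-out = λ i i<k → proj₂ (edge i i<k)
    ; end-in   = subst (Matched _) (sym (even-parity even-k N M)) end-in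
    ; end-out  = subst (λ X → ¬ Matched _ X) (sym (even-parity even-k M N)) end-out
    }
    where
      edge : ∀ i → i < k →
        InM (alternate i M N) (p i) (p (suc i)) × ¬ InM (alternate i N M) (p i) (p (suc i))
      edge i i<k with even-or-odd i
      ... | inj₁ even rewrite even-parity even M N | even-parity even N M =
        even-in i i<k even , symDiff-exclusive (symDiff i i<k) (even-in i i<k even)
      ... | inj₂ odd rewrite odd-parity odd M N | odd-parity odd N M =
        odd-in i i<k ¬even , symDiff-exclusive (swap (symDiff i i<k)) (odd-in i i<k ¬even)
        where ¬even = λ even → even⇒¬odd even odd

lemma4p6 : ∀ {n} (G : Graph n) (L : List (Pair n)) (u v : Fin n) →
    Matched u (R₋ G v L) → ¬ Matched u (R G L) →
    (k : ℕ) (p : ℕ → Fin n) → IsAltPath (R G L) (R₋ G v L) k p →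
    p 0 ≡ v → p k ≡ u →
    ∀ i → i < k → Even i → Victim G L u (p i)
lemma4p6 {n} G L _ _ matched-without-v unmatched k p path refl refl i i<k even-i =
  unmatched , victim-matched G L i<k blocking
  where
    everyone : Avail n
    everyone _ = true
    even-k : Even k
    even-k = even-length k path unmatched
    blocking : Blocking G L everyone (everyone ∖ p 0) (everyone ∖ p i) p i k
    blocking = record
      { start-removed   = λ _ → refl
      ; blocker-removed = λ x → cong (λ X → (X ∖ p i) x) (sym (even-parity even-i _ _))
      ; same-parity     = λ x y → trans (even-parity even-i x y) (sym (even-parity even-k x y))
      ; alternating     = isAltPath⇒alternating path even-k matched-without-v unmatched
      }
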